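{- Let $i\in I_0$, let $b\in\mathcal{B}^{\otimes\ell}$ be $\{1,2,\dots,i\}$-highest weight, and let $1\le k\le i$. If a letter $b_r=a$ of $b=b_1b_2\cdots b_\ell$ is $k$-bracketed, then $b_r$ is $j$-bracketed for all $a<j\le k$.
   Context: Fix $n\ge1$, $\ell\ge1$, $I_0=\{1,\dots,n\}$. $\mathcal{B}^{\otimes\ell}$ is the set of words $b=b_1\cdots b_\ell$ with letters in $\{1,\dots,n+1\}$. Crystal bracketing of $j+1$'s and $j$'s in a sequence: repeatedly pair a $j+1$ with a $j$ immediately to its right in the current sequence and remove the pair (removed letters are bracketed). For $i\in I_0$, $e_i(b)$ changes the leftmost unbracketed $i+1$ (in the bracketing of the subsequence of letters $i,i+1$) to $i$, and is $0$ if none exists; $b$ is $J$-highest weight if $e_j(b)=0$ for all $j\in J$. $k$-bracketed entries of a word: every letter $k$ is $k$-bracketed; for $j=k-1,k-2,\dots,1$ successively, perform the crystal bracketing on the subsequence consisting of the $k$-bracketed $(j+1)$'s and all $j$'s; the $j$'s that are bracketed are the $k$-bracketed $j$'s. -}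

module Defs where

open import Data.Nat using (ℕ; zero; suc; _∸_; _≡ᵇ_; _≤_)
open import Data.Bool using (Bool; true; false; if_then_else_; _∨_)
open import Data.List using (List; []; _∷_; length; lookup)
open import Data.List.Relation.Unary.All using (All)
open import Data.Maybe using (Maybe; just; nothing)
open import Data.Product using (_×_; _,_)
open import Data.Fin using (Fin; toℕ)
open import Relation.Binary.PropositionalEquality using (_≡_)

-- Words b = b₁⋯b_ℓ are lists of naturals; positions are 0-based indices.

InB⊗ : ℕ → ℕ → List ℕ → Set
InB⊗ n ℓ b = (length b ≡ ℓ) × All (λ x → (1 ≤ x) × (x ≤ suc n)) b

indexedFrom : ℕ → List ℕ → List (ℕ × ℕ)
indexedFrom p []       = []
indexedFrom p (x ∷ xs) = (p , x) ∷ indexedFrom (suc p) xs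

indexed : List ℕ → List (ℕ × ℕ)
indexed = indexedFrom 0

elem : ℕ → List ℕ → Bool
elem p []       = false
elem p (q ∷ qs) = (p ≡ᵇ q) ∨ elem p qs

-- Crystal bracketing of a sequence of letters, each given by its position and
-- a flag: true = a "j+1", false = a "j".  Scanning left to right with a stack
-- of so far unbracketed (j+1)'s, each j is paired with the nearest unbracketed
-- (j+1) to its left; this is exactly the result of repeatedly removing a pair
-- (j+1, j) adjacent in the current sequence.
bracketGo : List ℕ → List (ℕ × Bool) → List ℕ
bracketGo st       []                  = []
bracketGo st       ((p , true)  ∷ xs) = bracketGo (p ∷ st) xs
bracketGo []       ((p , false) ∷ xs) = bracketGo [] xs
bracketGo (q ∷ st) ((p , false) ∷ xs) = q ∷ p ∷ bracketGo st xs

bracketed : List (ℕ × Bool) → List ℕ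
bracketed = bracketGo []

subseqᵢ : ℕ → List (ℕ × ℕ) → List (ℕ × Bool)
subseqᵢ i []             = []
subseqᵢ i ((p , x) ∷ xs) =
  if x ≡ᵇ suc i then (p , true) ∷ subseqᵢ i xs
  else (if x ≡ᵇ i then (p , false) ∷ subseqᵢ i xs else subseqᵢ i xs)

unbracketedTop : List ℕ → List (ℕ × Bool) → List ℕ
unbracketedTop br []                  = []
unbracketedTop br ((p , true)  ∷ xs) =
  if elem p br then unbracketedTop br xs else p ∷ unbracketedTop br xs
unbracketedTop br ((p , false) ∷ xs) = unbracketedTop br xs

setAt : List ℕ → ℕ → ℕ → List ℕ
setAt []       p       v = []
setAt (x ∷ xs) zero    v = v ∷ xs
setAt (x ∷ xs) (suc p) v = x ∷ setAt xs p v

-- crystal operator e_i (nothing plays the role of 0)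
e : ℕ → List ℕ → Maybe (List ℕ)
e i b with unbracketedTop (bracketed (subseqᵢ i (indexed b))) (subseqᵢ i (indexed b))
... | []      = nothing
... | (p ∷ _) = just (setAt b p i)

HighestWeightUpTo : ℕ → List ℕ → Set
HighestWeightUpTo i b = ∀ j → 1 ≤ j → j ≤ i → e j b ≡ nothing

positionsOf : ℕ → List (ℕ × ℕ) → List ℕ
positionsOf a []             = []
positionsOf a ((p , x) ∷ xs) = if x ≡ᵇ a then p ∷ positionsOf a xs else positionsOf a xs

subseqK : ℕ → List ℕ → List (ℕ × ℕ) → List (ℕ × Bool)
subseqK j S []             = []
subseqK j S ((p , x) ∷ xs) =
  if (x ≡ᵇ suc j) Data.Bool.∧ elem p S then (p , true) ∷ subseqK j S xs
  else (if x ≡ᵇ j then (p , false) ∷ subseqK j S xs else subseqK j S xs)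

bracketedBottom : List ℕ → List (ℕ × Bool) → List ℕ
bracketedBottom br []                  = []
bracketedBottom br ((p , true)  ∷ xs) = bracketedBottom br xs
bracketedBottom br ((p , false) ∷ xs) =
  if elem p br then p ∷ bracketedBottom br xs else bracketedBottom br xs

-- kLevel k d b = positions of the k-bracketed letters equal to k ∸ d
-- (meaningful for d < k): all k's for d = 0, then j = k-1, k-2, … successively.
kLevel : ℕ → ℕ → List ℕ → List ℕ
kLevel k zero    b = positionsOf k (indexed b)
kLevel k (suc d) b =
  let j = k ∸ suc d
      s = subseqK j (kLevel k d b) (indexed b)
  in bracketedBottom (bracketed s) s

KBracketed : ℕ → (b : List ℕ) → Fin (length b) → Set
KBracketed k b r =
  (1 ≤ lookup b r) × (lookup b r ≤ k) × (elem (toℕ r) (kLevel k (k ∸ lookup b r) b) ≡ true)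

-- Passing from k to k + 1 shrinks every level of the bracketing.  The
-- (k+1)-bracketed k's are k's, hence k-bracketed; and if the (k+1)-bracketed
-- (j+1)'s are among the k-bracketed (j+1)'s, then bracketing the j's against
-- fewer (j+1)'s brackets fewer j's, since inserting (j+1)'s only lengthens
-- the stack of open (j+1)'s met by each j.  Descending from k to j one step
-- at a time proves the claim.
module Submission where

open import Defs
open import Data.Bool using (Bool; true; false; if_then_else_)
open import Data.Bool.Properties using (T-≡; ∨-zeroʳ)
open import Data.Empty using (⊥; ⊥-elim)
open import Data.Fin using (Fin)
open import Data.List using (List; []; _∷_; length; lookup)
open import Data.List.Membership.Propositional using (_∈_)
open import Data.List.Relation.Binary.Subset.Propositional using (_⊆_)
open import Data.List.Relation.Unary.Any using (here; there)
open import Data.Nat using (ℕ; zero; suc; _≤_; _<_; _∸_; _≡ᵇ_; _≤′_; ≤′-refl; ≤′-step; z≤n; s≤s)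
open import Data.Nat.Properties
  using (≡ᵇ⇒≡; ≡⇒≡ᵇ; 1+n≢n; ≤⇒≤′; ≤′⇒≤; <⇒≤; ≤-refl; ≤-trans; <-irrefl; +-∸-assoc; m≤n⇒m≤1+n)
open import Data.Product using (_×_; _,_; proj₁)
open import Data.Sum using (_⊎_; inj₁; inj₂)
open import Function using (id; _∘_)
open import Function.Bundles using (module Equivalence)
open import Relation.Binary.PropositionalEquality using (_≡_; refl; sym; trans; cong)

≡ᵇ-true⇒≡ : ∀ {m n} → (m ≡ᵇ n) ≡ true → m ≡ n
≡ᵇ-true⇒≡ {m} {n} eq = ≡ᵇ⇒≡ m n (Equivalence.from T-≡ eq)

≡ᵇ-refl : ∀ n → (n ≡ᵇ n) ≡ true
≡ᵇ-refl n = Equivalence.to T-≡ (≡⇒≡ᵇ n n refl)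

elem⇒∈ : ∀ {p} qs → elem p qs ≡ true → p ∈ qs
elem⇒∈ {p} (q ∷ qs) h with p ≡ᵇ q in eq
... | true  = here (≡ᵇ-true⇒≡ eq)
... | false = there (elem⇒∈ qs h)

∈⇒elem : ∀ {p qs} → p ∈ qs → elem p qs ≡ true
∈⇒elem {p} (here refl) rewrite ≡ᵇ-refl p = refl
∈⇒elem {p} {q ∷ _} (there m) rewrite ∈⇒elem m = ∨-zeroʳ (p ≡ᵇ q)

∈-positionsOf⁺ : ∀ {p a} xs → (p , a) ∈ xs → p ∈ positionsOf a xs
∈-positionsOf⁺ {a = a} ((q , x) ∷ xs) m with x ≡ᵇ a in eq | m
... | true  | here refl = here refl
... | true  | there m′ = there (∈-positionsOf⁺ xs m′)
... | false | there m′ = ∈-positionsOf⁺ xs m′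
... | false | here refl with trans (sym eq) (≡ᵇ-refl a)
...   | ()

indexedFrom-≥ : ∀ {p x} q b → (p , x) ∈ indexedFrom q b → q ≤ p
indexedFrom-≥ q (_ ∷ b) (here refl) = ≤-refl
indexedFrom-≥ q (_ ∷ b) (there m)   = <⇒≤ (indexedFrom-≥ (suc q) b m)

indexedFrom-functional : ∀ {p x y} q b →
  (p , x) ∈ indexedFrom q b → (p , y) ∈ indexedFrom q b → x ≡ y
indexedFrom-functional q (_ ∷ b) (here refl) (here refl) = refl
indexedFrom-functional q (_ ∷ b) (here refl) (there m)   = ⊥-elim (<-irrefl refl (indexedFrom-≥ (suc q) b m))
indexedFrom-functional q (_ ∷ b) (there m)   (here refl) = ⊥-elim (<-irrefl refl (indexedFrom-≥ (suc q) b m))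
indexedFrom-functional q (_ ∷ b) (there m)   (there m′)  = indexedFrom-functional (suc q) b m m′

matchedBottoms : List ℕ → List (ℕ × Bool) → List ℕ
matchedBottoms st       []                  = []
matchedBottoms st       ((p , true)  ∷ xs) = matchedBottoms (p ∷ st) xs
matchedBottoms []       ((p , false) ∷ xs) = matchedBottoms [] xs
matchedBottoms (q ∷ st) ((p , false) ∷ xs) = p ∷ matchedBottoms st xs

matchedBottoms⊆bracketGo : ∀ st s → matchedBottoms st s ⊆ bracketGo st s
matchedBottoms⊆bracketGo st       ((q , true)  ∷ xs) m           = matchedBottoms⊆bracketGo (q ∷ st) xs m
matchedBottoms⊆bracketGo []       ((q , false) ∷ xs) m           = matchedBottoms⊆bracketGo [] xs m
matchedBottoms⊆bracketGo (_ ∷ st) ((q , false) ∷ xs) (here refl) = there (here refl)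
matchedBottoms⊆bracketGo (_ ∷ st) ((q , false) ∷ xs) (there m)   = there (there (matchedBottoms⊆bracketGo st xs m))

∈-bracketGo⁻ : ∀ {p} st s → p ∈ bracketGo st s →
  p ∈ matchedBottoms st s ⊎ p ∈ st ⊎ (p , true) ∈ s
∈-bracketGo⁻ st ((q , true) ∷ xs) m with ∈-bracketGo⁻ (q ∷ st) xs m
... | inj₁ matched             = inj₁ matched
... | inj₂ (inj₁ (here refl))  = inj₂ (inj₂ (here refl))
... | inj₂ (inj₁ (there onStack)) = inj₂ (inj₁ onStack)
... | inj₂ (inj₂ top)          = inj₂ (inj₂ (there top))
∈-bracketGo⁻ [] ((q , false) ∷ xs) m with ∈-bracketGo⁻ [] xs m
... | inj₁ matched    = inj₁ matched
... | inj₂ (inj₂ top) = inj₂ (inj₂ (there top))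
∈-bracketGo⁻ (_ ∷ st) ((q , false) ∷ xs) (here refl)         = inj₂ (inj₁ (here refl))
∈-bracketGo⁻ (_ ∷ st) ((q , false) ∷ xs) (there (here refl)) = inj₁ (here refl)
∈-bracketGo⁻ (_ ∷ st) ((q , false) ∷ xs) (there (there m)) with ∈-bracketGo⁻ st xs m
... | inj₁ matched     = inj₁ (there matched)
... | inj₂ (inj₁ onStack) = inj₂ (inj₁ (there onStack))
... | inj₂ (inj₂ top)  = inj₂ (inj₂ (there top))

∈-bracketedBottom⁻ : ∀ {p br} s → p ∈ bracketedBottom br s → (p , false) ∈ s × p ∈ br
∈-bracketedBottom⁻ ((q , true) ∷ xs) m with ∈-bracketedBottom⁻ xs m
... | bottom , inBr = there bottom , inBr
∈-bracketedBottom⁻ {br = br} ((q , false) ∷ xs) m with elem q br in eq | m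
... | true | here refl = here refl , elem⇒∈ br eq
... | true | there m′ with ∈-bracketedBottom⁻ xs m′
...   | bottom , inBr = there bottom , inBr
∈-bracketedBottom⁻ ((q , false) ∷ xs) m | false | m′ with ∈-bracketedBottom⁻ xs m′
...   | bottom , inBr = there bottom , inBr

∈-bracketedBottom⁺ : ∀ {p br s} → (p , false) ∈ s → p ∈ br → p ∈ bracketedBottom br s
∈-bracketedBottom⁺ {s = (q , true) ∷ xs} (there bottom) inBr = ∈-bracketedBottom⁺ bottom inBr
∈-bracketedBottom⁺ {br = br} {(q , false) ∷ xs} bottom inBr with elem q br in eq | bottom
... | true  | here refl    = here refl
... | true  | there bottom′ = there (∈-bracketedBottom⁺ bottom′ inBr)
... | false | there bottom′ = ∈-bracketedBottom⁺ bottom′ inBr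
... | false | here refl with trans (sym eq) (∈⇒elem inBr)
...   | ()

data _⊑_ : List (ℕ × Bool) → List (ℕ × Bool) → Set where
  ⊑-[]        : [] ⊑ []
  ⊑-keep      : ∀ {x s s′} → s ⊑ s′ → (x ∷ s) ⊑ (x ∷ s′)
  ⊑-insertTop : ∀ {q s s′} → s ⊑ s′ → s ⊑ ((q , true) ∷ s′)

⊑-bottom : ∀ {p s s′} → s ⊑ s′ → (p , false) ∈ s → (p , false) ∈ s′
⊑-bottom (⊑-keep s⊑s′)      (here refl) = here refl
⊑-bottom (⊑-keep s⊑s′)      (there m)   = there (⊑-bottom s⊑s′ m)
⊑-bottom (⊑-insertTop s⊑s′) m           = there (⊑-bottom s⊑s′ m)

matchedBottoms-mono : ∀ {s s′} → s ⊑ s′ → ∀ {st st′} → length st ≤ length st′ →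
  matchedBottoms st s ⊆ matchedBottoms st′ s′
matchedBottoms-mono (⊑-keep {q , true} s⊑s′) st≤st′ m =
  matchedBottoms-mono s⊑s′ (s≤s st≤st′) m
matchedBottoms-mono (⊑-keep {q , false} s⊑s′) {[]} {[]} st≤st′ m =
  matchedBottoms-mono s⊑s′ st≤st′ m
matchedBottoms-mono (⊑-keep {q , false} s⊑s′) {[]} {_ ∷ _} st≤st′ m =
  there (matchedBottoms-mono s⊑s′ z≤n m)
matchedBottoms-mono (⊑-keep {q , false} s⊑s′) {_ ∷ _} {_ ∷ _} st≤st′ (here refl) = here refl
matchedBottoms-mono (⊑-keep {q , false} s⊑s′) {_ ∷ _} {_ ∷ _} (s≤s st≤st′) (there m) =
  there (matchedBottoms-mono s⊑s′ st≤st′ m)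
matchedBottoms-mono (⊑-insertTop s⊑s′) st≤st′ m =
  matchedBottoms-mono s⊑s′ (m≤n⇒m≤1+n st≤st′) m

Unambiguous : List (ℕ × Bool) → Set
Unambiguous s = ∀ {p} → (p , true) ∈ s → (p , false) ∈ s → ⊥

bracketedBottom-mono : ∀ {s s′} → s ⊑ s′ → Unambiguous s →
  bracketedBottom (bracketed s) s ⊆ bracketedBottom (bracketed s′) s′
bracketedBottom-mono {s} {s′} s⊑s′ unambiguous m with ∈-bracketedBottom⁻ s m
... | bottom , inBr with ∈-bracketGo⁻ [] s inBr
...   | inj₁ matched = ∈-bracketedBottom⁺ (⊑-bottom s⊑s′ bottom)
          (matchedBottoms⊆bracketGo [] s′ (matchedBottoms-mono s⊑s′ z≤n matched))
...   | inj₂ (inj₂ top) = ⊥-elim (unambiguous top bottom)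

∈-subseqK⁻ : ∀ {j S p f} xs → (p , f) ∈ subseqK j S xs → (p , (if f then suc j else j)) ∈ xs
∈-subseqK⁻ {j} {S} ((q , x) ∷ xs) m with x ≡ᵇ suc j in isTop | elem q S | x ≡ᵇ j in isBottom | m
... | true  | true  | _     | here refl = here (cong (q ,_) (sym (≡ᵇ-true⇒≡ isTop)))
... | true  | true  | _     | there m′  = there (∈-subseqK⁻ xs m′)
... | true  | false | true  | here refl = here (cong (q ,_) (sym (≡ᵇ-true⇒≡ isBottom)))
... | true  | false | true  | there m′  = there (∈-subseqK⁻ xs m′)
... | true  | false | false | m′        = there (∈-subseqK⁻ xs m′)
... | false | _     | true  | here refl = here (cong (q ,_) (sym (≡ᵇ-true⇒≡ isBottom)))
... | false | _     | true  | there m′  = there (∈-subseqK⁻ xs m′)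
... | false | _     | false | m′        = there (∈-subseqK⁻ xs m′)

subseqK-unambiguous : ∀ j S b → Unambiguous (subseqK j S (indexed b))
subseqK-unambiguous j S b top bottom =
  1+n≢n (indexedFrom-functional 0 b (∈-subseqK⁻ (indexed b) top) (∈-subseqK⁻ (indexed b) bottom))

subseqK-mono : ∀ {j S S′} → S ⊆ S′ → ∀ xs → subseqK j S xs ⊑ subseqK j S′ xs
subseqK-mono S⊆S′ [] = ⊑-[]
subseqK-mono {j} {S} {S′} S⊆S′ ((p , x) ∷ xs) with x ≡ᵇ suc j in isTop | x ≡ᵇ j in isBottom
... | true  | true  = ⊥-elim (1+n≢n (trans (sym (≡ᵇ-true⇒≡ {x} isTop)) (≡ᵇ-true⇒≡ isBottom)))
... | false | true  = ⊑-keep (subseqK-mono S⊆S′ xs)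
... | false | false = subseqK-mono S⊆S′ xs
... | true  | false with elem p S in inS | elem p S′ in inS′
...   | true  | true  = ⊑-keep (subseqK-mono S⊆S′ xs)
...   | false | true  = ⊑-insertTop (subseqK-mono S⊆S′ xs)
...   | false | false = subseqK-mono S⊆S′ xs
...   | true  | false with trans (sym inS′) (∈⇒elem (S⊆S′ (elem⇒∈ S inS)))
...     | ()

kLevel-suc : ∀ b k d → kLevel (suc k) (suc d) b ⊆ kLevel k d b
kLevel-suc b k zero m =
  ∈-positionsOf⁺ (indexed b) (∈-subseqK⁻ (indexed b) (proj₁ (∈-bracketedBottom⁻ _ m)))
kLevel-suc b k (suc d) =
  bracketedBottom-mono (subseqK-mono (kLevel-suc b k d) (indexed b)) (subseqK-unambiguous _ _ b)

kLevel-descend : ∀ b {a j k} → a < j → j ≤′ k → kLevel k (k ∸ a) b ⊆ kLevel j (j ∸ a) b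
kLevel-descend b a<j ≤′-refl = id
kLevel-descend b {a} {k = suc k} a<j (≤′-step j≤′k)
  rewrite +-∸-assoc 1 (≤-trans (<⇒≤ a<j) (≤′⇒≤ j≤′k)) =
  kLevel-descend b a<j j≤′k ∘ kLevel-suc b k (k ∸ a)

lemma2p19 : (n ℓ : ℕ) → 1 ≤ n → 1 ≤ ℓ →
    (i : ℕ) → 1 ≤ i → i ≤ n →
    (b : List ℕ) → InB⊗ n ℓ b → HighestWeightUpTo i b →
    (k : ℕ) → 1 ≤ k → k ≤ i →
    (r : Fin (length b)) → KBracketed k b r →
    (j : ℕ) → lookup b r < j → j ≤ k → KBracketed j b r
lemma2p19 n ℓ _ _ i _ _ b _ _ k _ _ r (1≤a , _ , kBracketed) j a<j j≤k =
  1≤a , <⇒≤ a<j , ∈⇒elem (kLevel-descend b a<j (≤⇒≤′ j≤k) (elem⇒∈ _ kBracketed))
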